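{- Fix $a,b\in\mathbb{N}$. For every $k\ge1$, every point $(i,j)\in S_{a,b,k}$ satisfies $ai+bj<(k+1)ab$, and $S_{a,b,k}$ contains $\{(i,j)\in\mathbb{Z}_+^2:ai+bj<kab\}$. Furthermore, for $k_1,k_2\in\mathbb{N}$, $S_{a,b,k_1}\boxplus S_{a,b,k_2}=S_{a,b,k_1+k_2}$.
   Context: $\mathbb{Z}_+=\{0,1,2,\dots\}$, $\mathbb{N}=\{1,2,\dots\}$. For $a,b\in\mathbb{N}$, $R_{a,b}=([0,a-1]\times[0,b-1])\cap\mathbb{Z}_+^2$. The $(a,b)$-staircase of size $k$ is $S_{a,b,k}=\bigcup_{j=1}^kR_{bj,a(k+1-j)}=\{(i,j)\in\mathbb{Z}_+^2:\lfloor i/b\rfloor+\lfloor j/a\rfloor\le k-1\}$. For $X\subseteq\mathbb{Z}_+^2$, $X^c=\mathbb{Z}_+^2\setminus X$; the infimal sum of Young diagrams (coordinatewise downward closed subsets of $\mathbb{Z}_+^2$) is $X\boxplus Y=(X^c+Y^c)^c$, with $+$ the Minkowski sum. -}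

module Defs where

open import Data.Nat using (ℕ; _+_; _*_; _∸_; _≤_; _<_)
open import Data.Product using (Σ; ∃; _×_; _,_)
open import Relation.Nullary using (¬_)
open import Relation.Binary.PropositionalEquality using (_≡_)

-- Subsets of ℤ₊² as predicates on pairs of naturals.
Subset² : Set₁
Subset² = ℕ → ℕ → Set

R : ℕ → ℕ → Subset²
R a b i j = (i < a) × (j < b)

S : ℕ → ℕ → ℕ → Subset²
S a b k i j = Σ ℕ λ t → (1 ≤ t) × (t ≤ k) × R (b * t) (a * ((k + 1) ∸ t)) i j

_ᶜ : Subset² → Subset²
(X ᶜ) i j = ¬ X i j

_⊕_ : Subset² → Subset² → Subset²
(X ⊕ Y) i j = Σ ℕ λ i₁ → Σ ℕ λ j₁ → Σ ℕ λ i₂ → Σ ℕ λ j₂ →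
  X i₁ j₁ × Y i₂ j₂ × (i₁ + i₂ ≡ i) × (j₁ + j₂ ≡ j)

_⊞_ : Subset² → Subset² → Subset²
X ⊞ Y = ((X ᶜ) ⊕ (Y ᶜ)) ᶜ

_≐_ : Subset² → Subset² → Set
X ≐ Y = (∀ i j → X i j → Y i j) × (∀ i j → Y i j → X i j)

module Submission where

-- The (a,b)-staircase of size k is a sublevel set of the "level" function
--   level(i,j) = ⌊i/b⌋ + ⌊j/a⌋,   namely   S_{a,b,k} = { (i,j) : level(i,j) < k }.
--
-- A point of the t-th rectangle R_{bt, a(k+1-t)} has
--    a·i + b·j < ab·t + ab·(k+1-t) = (k+1)ab; conversely level(i,j)·ab ≤ a·i + b·j,
--    so a·i + b·j < k·ab forces level(i,j) < k.
--  * Infimal sum.  The complement of S_k is { level ≥ k } and level is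
--    superadditive (floor division is), so a sum of a point outside S_{k₁} and a
--    point outside S_{k₂} lies outside S_{k₁+k₂}.  Conversely a point of level at
--    least k₁ + k₂ splits as a lattice corner (p·b, q·a) with p + q = k₁, which
--    lies outside S_{k₁}, plus a remainder of level at least k₂.

open import Defs
open import Data.Nat using (ℕ; suc; _+_; _*_; _∸_; _⊓_; _≤_; _<_; z≤n; s≤s; NonZero; _<?_)
open import Data.Nat.Properties
open import Data.Nat.DivMod using (_/_; m<n*o⇒m/o<n; m*n/n≡m; m/n*n≤m; /-monoˡ-≤; [m∸n*o]/o≡m/o∸n)
open import Data.Product using (Σ; _×_; _,_)
open import Relation.Nullary using (¬_)
open import Relation.Nullary.Decidable using (decidable-stable)
open import Relation.Binary.PropositionalEquality using (_≡_; refl; sym; trans; cong; cong₂; subst; module ≡-Reasoning)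
open import Algebra.Properties.CommutativeSemigroup +-commutativeSemigroup
  using () renaming (interchange to +-interchange)
open import Algebra.Properties.CommutativeSemigroup *-commutativeSemigroup
  using () renaming (x∙yz≈y∙xz to *-left-swap; x∙yz≈z∙xy to *-rotate)

<*⇒/< : ∀ n {i t} .{{_ : NonZero n}} → i < n * t → i / n < t
<*⇒/< n {i} {t} i<nt = m<n*o⇒m/o<n (subst (i <_) (*-comm n t) i<nt)

*≤⇒≤/ : ∀ n {t i} .{{_ : NonZero n}} → t * n ≤ i → t ≤ i / n
*≤⇒≤/ n {t} {i} tn≤i = subst (_≤ i / n) (m*n/n≡m t n) (/-monoˡ-≤ n tn≤i)

/<⇒<* : ∀ n {i t} .{{_ : NonZero n}} → i / n < t → i < n * t
/<⇒<* n {i} {t} i/n<t = subst (i <_) (*-comm t n)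
  (≰⇒> (λ tn≤i → <⇒≱ i/n<t (*≤⇒≤/ n tn≤i)))

/-superadditive : ∀ m n d .{{_ : NonZero d}} → m / d + n / d ≤ (m + n) / d
/-superadditive m n d = *≤⇒≤/ d (begin
  (m / d + n / d) * d     ≡⟨ *-distribʳ-+ d (m / d) (n / d) ⟩
  m / d * d + n / d * d   ≤⟨ +-mono-≤ (m/n*n≤m m d) (m/n*n≤m n d) ⟩
  m + n                   ∎)
  where open ≤-Reasoning

+-take : ∀ {p q P Q} → p ≤ P → q ≤ Q → (p + q) + ((P ∸ p) + (Q ∸ q)) ≡ P + Q
+-take {p} {q} {P} {Q} p≤P q≤Q = begin
  (p + q) + ((P ∸ p) + (Q ∸ q))   ≡⟨ +-interchange p q (P ∸ p) (Q ∸ q) ⟩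
  (p + (P ∸ p)) + (q + (Q ∸ q))   ≡⟨ cong₂ _+_ (m+[n∸m]≡n p≤P) (m+[n∸m]≡n q≤Q) ⟩
  P + Q                           ∎
  where open ≡-Reasoning

budget-split : ∀ {k₁ k₂ P Q} → k₁ + k₂ ≤ P + Q →
  Σ ℕ λ p → Σ ℕ λ q → p ≤ P × q ≤ Q × p + q ≡ k₁ × k₂ ≤ (P ∸ p) + (Q ∸ q)
budget-split {k₁} {k₂} {P} {Q} k≤PQ = p , q , p≤P , q≤Q , p+q≡k₁ , k₂≤rest
  where
  p q : ℕ
  p = P ⊓ k₁
  q = k₁ ∸ P
  p≤P : p ≤ P
  p≤P = m⊓n≤m P k₁
  q≤Q : q ≤ Q
  q≤Q = m≤n+o⇒m∸n≤o k₁ P (≤-trans (m≤m+n k₁ k₂) k≤PQ)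
  p+q≡k₁ : p + q ≡ k₁
  p+q≡k₁ = m⊓n+n∸m≡n P k₁
  k₂≤rest : k₂ ≤ (P ∸ p) + (Q ∸ q)
  k₂≤rest = +-cancelˡ-≤ k₁ k₂ _ (begin
    k₁ + k₂                              ≤⟨ k≤PQ ⟩
    P + Q                                ≡⟨ sym (+-take p≤P q≤Q) ⟩
    (p + q) + ((P ∸ p) + (Q ∸ q))        ≡⟨ cong (_+ ((P ∸ p) + (Q ∸ q))) p+q≡k₁ ⟩
    k₁ + ((P ∸ p) + (Q ∸ q))             ∎)
    where open ≤-Reasoning

height-index : ∀ {k t} → t ≤ k → k + 1 ∸ t ≡ suc (k ∸ t)
height-index {k} {t} t≤k = trans (+-∸-comm 1 t≤k) (+-comm (k ∸ t) 1)

module Staircase (a b : ℕ) .{{_ : NonZero a}} .{{_ : NonZero b}} where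

  level : ℕ → ℕ → ℕ
  level i j = i / b + j / a

  -- In the t-th rectangle ⌊i/b⌋ < t and ⌊j/a⌋ ≤ k - t.
  S⇒level< : ∀ {k i j} → S a b k i j → level i j < k
  S⇒level< {k} {i} {j} (t , _ , t≤k , i<bt , j<a[k+1-t]) =
    subst (level i j <_) (m+[n∸m]≡n t≤k) (+-mono-<-≤ (<*⇒/< b i<bt) j/a≤k-t)
    where
    j/a≤k-t : j / a ≤ k ∸ t
    j/a≤k-t = m<1+n⇒m≤n (<*⇒/< a (subst (λ h → j < a * h) (height-index t≤k) j<a[k+1-t]))

  -- A point of level below k lies in the rectangle with t = ⌊i/b⌋ + 1.
  level<⇒S : ∀ {k i j} → level i j < k → S a b k i j
  level<⇒S {k} {i} {j} lvl<k =
    suc (i / b) , s≤s z≤n , m+n≤o⇒m≤o (suc (i / b)) lvl<k , /<⇒<* b ≤-refl , j<height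
    where
    j/a≤rest : j / a ≤ k ∸ suc (i / b)
    j/a≤rest = m+n≤o⇒m≤o∸n (j / a) (subst (_≤ k) (+-comm (suc (i / b)) (j / a)) lvl<k)
    j<height : j < a * (k + 1 ∸ suc (i / b))
    j<height = subst (λ h → j < a * h) (sym (height-index (m+n≤o⇒m≤o (suc (i / b)) lvl<k)))
      (/<⇒<* a (s≤s j/a≤rest))

  ≤level⇒∉S : ∀ {k i j} → k ≤ level i j → ¬ S a b k i j
  ≤level⇒∉S k≤lvl s = <⇒≱ (S⇒level< s) k≤lvl

  ∉S⇒≤level : ∀ {k i j} → ¬ S a b k i j → k ≤ level i j
  ∉S⇒≤level ∉S = ≮⇒≥ (λ lvl<k → ∉S (level<⇒S lvl<k))

  -- Inherited from the superadditivity of floor division in each coordinate.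
  level-superadditive : ∀ i₁ j₁ i₂ j₂ → level i₁ j₁ + level i₂ j₂ ≤ level (i₁ + i₂) (j₁ + j₂)
  level-superadditive i₁ j₁ i₂ j₂ = begin
    (i₁ / b + j₁ / a) + (i₂ / b + j₂ / a) ≡⟨ +-interchange (i₁ / b) (j₁ / a) (i₂ / b) (j₂ / a) ⟩
    (i₁ / b + i₂ / b) + (j₁ / a + j₂ / a) ≤⟨ +-mono-≤ (/-superadditive i₁ i₂ b) (/-superadditive j₁ j₂ a) ⟩
    (i₁ + i₂) / b + (j₁ + j₂) / a         ∎
    where open ≤-Reasoning

  level-weight : ∀ i j → level i j * (a * b) ≤ a * i + b * j
  level-weight i j = begin
    (i / b + j / a) * (a * b)            ≡⟨ *-distribʳ-+ (a * b) (i / b) (j / a) ⟩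
    i / b * (a * b) + j / a * (a * b)    ≡⟨ cong₂ _+_ (*-left-swap (i / b) a b) (*-rotate (j / a) a b) ⟩
    a * (i / b * b) + b * (j / a * a)    ≤⟨ +-mono-≤ (*-monoʳ-≤ a (m/n*n≤m i b)) (*-monoʳ-≤ b (m/n*n≤m j a)) ⟩
    a * i + b * j                        ∎
    where open ≤-Reasoning

  -- Every point of S_k has weight below (k+1)ab: the t-th rectangle has corner
  -- weight ab·t + ab·(k+1-t).
  S⇒weight< : ∀ {k i j} → S a b k i j → a * i + b * j < (k + 1) * (a * b)
  S⇒weight< {k} {i} {j} (t , _ , t≤k , i<bt , j<as) = begin-strict
    a * i + b * j                       <⟨ +-mono-< (*-monoʳ-< a i<bt) (*-monoʳ-< b j<as) ⟩
    a * (b * t) + b * (a * s)           ≡⟨ cong (a * (b * t) +_) (*-left-swap b a s) ⟩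
    a * (b * t) + a * (b * s)           ≡⟨ sym (*-distribˡ-+ a (b * t) (b * s)) ⟩
    a * (b * t + b * s)                 ≡⟨ cong (a *_) (sym (*-distribˡ-+ b t s)) ⟩
    a * (b * (t + s))                   ≡⟨ cong (λ h → a * (b * h)) (m+[n∸m]≡n (m≤n⇒m≤n+o 1 t≤k)) ⟩
    a * (b * (k + 1))                   ≡⟨ *-rotate a b (k + 1) ⟩
    (k + 1) * (a * b)                   ∎
    where
    s : ℕ
    s = k + 1 ∸ t
    open ≤-Reasoning

  weight<⇒S : ∀ {k i j} → a * i + b * j < k * (a * b) → S a b k i j
  weight<⇒S {k} {i} {j} w<kab =
    level<⇒S (*-cancelʳ-< (a * b) (level i j) k (≤-<-trans (level-weight i j) w<kab))

  -- A point of level ≥ k₁ + k₂ is a corner (p·b, q·a) of level p + q = k₁ plus a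
  -- remainder of level ≥ k₂, hence a sum of points outside S_{k₁} and S_{k₂}.
  ≤level⇒∈ᶜ⊕ᶜ : ∀ {k₁ k₂ i j} → k₁ + k₂ ≤ level i j → ((S a b k₁ ᶜ) ⊕ (S a b k₂ ᶜ)) i j
  ≤level⇒∈ᶜ⊕ᶜ {k₁} {k₂} {i} {j} k≤lvl with budget-split k≤lvl
  ... | p , q , p≤i/b , q≤j/a , p+q≡k₁ , k₂≤rest =
    p * b , q * a , i ∸ p * b , j ∸ q * a , corner∉S , remainder∉S ,
    m+[n∸m]≡n pb≤i , m+[n∸m]≡n qa≤j
    where
    pb≤i : p * b ≤ i
    pb≤i = ≤-trans (*-monoˡ-≤ b p≤i/b) (m/n*n≤m i b)
    qa≤j : q * a ≤ j
    qa≤j = ≤-trans (*-monoˡ-≤ a q≤j/a) (m/n*n≤m j a)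
    corner-level : level (p * b) (q * a) ≡ k₁
    corner-level = trans (cong₂ _+_ (m*n/n≡m p b) (m*n/n≡m q a)) p+q≡k₁
    remainder-level : level (i ∸ p * b) (j ∸ q * a) ≡ (i / b ∸ p) + (j / a ∸ q)
    remainder-level = cong₂ _+_ ([m∸n*o]/o≡m/o∸n i p b) ([m∸n*o]/o≡m/o∸n j q a)
    corner∉S : ¬ S a b k₁ (p * b) (q * a)
    corner∉S = ≤level⇒∉S (≤-reflexive (sym corner-level))
    remainder∉S : ¬ S a b k₂ (i ∸ p * b) (j ∸ q * a)
    remainder∉S = ≤level⇒∉S (subst (k₂ ≤_) (sym remainder-level) k₂≤rest)

  -- A sum of points outside S_{k₁} and S_{k₂} has level ≥ k₁ + k₂, so is not in S_{k₁+k₂}.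
  S⊆⊞ : ∀ k₁ k₂ i j → S a b (k₁ + k₂) i j → (S a b k₁ ⊞ S a b k₂) i j
  S⊆⊞ k₁ k₂ _ _ s (i₁ , j₁ , i₂ , j₂ , ∉S₁ , ∉S₂ , refl , refl) =
    <⇒≱ (S⇒level< s)
      (≤-trans (+-mono-≤ (∉S⇒≤level ∉S₁) (∉S⇒≤level ∉S₂)) (level-superadditive i₁ j₁ i₂ j₂))

  -- Level comparison is decidable, so it suffices to refute level ≥ k₁ + k₂.
  ⊞⊆S : ∀ k₁ k₂ i j → (S a b k₁ ⊞ S a b k₂) i j → S a b (k₁ + k₂) i j
  ⊞⊆S k₁ k₂ i j ∈⊞ = level<⇒S (decidable-stable (level i j <? k₁ + k₂)
    (λ lvl≮k → ∈⊞ (≤level⇒∈ᶜ⊕ᶜ (≮⇒≥ lvl≮k))))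

lemma6p1 : (a b : ℕ) → 1 ≤ a → 1 ≤ b →
    ((k : ℕ) → 1 ≤ k →
      ((i j : ℕ) → S a b k i j → a * i + b * j < (k + 1) * (a * b))
      × ((i j : ℕ) → a * i + b * j < k * (a * b) → S a b k i j))
    × ((k₁ k₂ : ℕ) → 1 ≤ k₁ → 1 ≤ k₂ → (S a b k₁ ⊞ S a b k₂) ≐ S a b (k₁ + k₂))
lemma6p1 (suc a) (suc b) _ _ =
  (λ k _ → (λ i j → S⇒weight<) , (λ i j → weight<⇒S)) ,
  (λ k₁ k₂ _ _ → ⊞⊆S k₁ k₂ , S⊆⊞ k₁ k₂)
  where open Staircase (suc a) (suc b)
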